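{- Let $H$ be an $n$-vertex graph with maximum degree $\Delta$ and average degree $d$, and suppose that $\chi(H)\ge 3$. Then $ER(H)>2^{\lceil nd/(2\Delta)\rceil-1}$.
   Context: $\chi(H)$ is the chromatic number. Edge-colorings of $K_N$ may use arbitrarily many colors. A copy of $H$ in $K_N$ (injective $\varphi:V(H)\to V(K_N)$) is canonically colored if it is monochromatic (all edges same color), rainbow (all edges distinct colors), or lexicographic: there is an ordering $v_1,\dots,v_n$ of $V(H)$ such that for each $i$ all edges $\varphi(v_i)\varphi(v_j)$ with $v_iv_j\in E(H)$, $j>i$, have the same color $c_i$, and these colors are distinct for different $v_i$. $ER(H)$ is the least $N$ such that every edge-coloring of $K_N$ contains a canonically colored copy of $H$. -}

module Defs where

open import Data.Nat using (ℕ; zero; suc; _+_; _*_; _∸_; _^_; _<_; _⊔_; _/_)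
open import Data.Bool using (Bool; true; false; if_then_else_)
open import Data.Fin using (Fin)
open import Data.List using (List; map; foldr; allFin)
open import Data.Nat.ListAction using (sum)
open import Data.Product using (Σ; ∃; _×_; _,_)
open import Data.Sum using (_⊎_)
open import Relation.Binary.PropositionalEquality using (_≡_; _≢_)
open import Relation.Nullary using (¬_)
open import Function.Definitions using (Injective)
open import Data.Fin.Permutation using (Permutation′; _⟨$⟩ʳ_)
import Data.Fin as F

record Graph (n : ℕ) : Set where
  field
    adj    : Fin n → Fin n → Bool
    sym    : ∀ u v → adj u v ≡ adj v u
    irrefl : ∀ v → adj v v ≡ false
open Graph public

Adj : ∀ {n} → Graph n → Fin n → Fin n → Set
Adj H u v = adj H u v ≡ true

deg : ∀ {n} → Graph n → Fin n → ℕ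
deg {n} H v = sum (map (λ u → if adj H v u then 1 else 0) (allFin n))

maxDeg : ∀ {n} → Graph n → ℕ
maxDeg {n} H = foldr _⊔_ 0 (map (deg H) (allFin n))

-- sum of degrees = n · d, where d is the average degree
degSum : ∀ {n} → Graph n → ℕ
degSum {n} H = sum (map (deg H) (allFin n))

-- ceiling division ⌈ a / b ⌉ (with the junk value 0 when b = 0)
ceilDiv : ℕ → ℕ → ℕ
ceilDiv a zero    = 0
ceilDiv a (suc b) = (a + b) / suc b

-- proper vertex colouring with k colours; χ(H) ≥ 3 iff H is not 2-colourable
Colorable : ∀ {n} → Graph n → ℕ → Set
Colorable {n} H k = Σ (Fin n → Fin k) λ col → ∀ u v → Adj H u v → col u ≢ col v

-- an edge-colouring of K_N with colours in ℕ (arbitrarily many colours);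
-- only values on pairs of distinct vertices matter
record EdgeColoring (N : ℕ) : Set where
  field
    col     : Fin N → Fin N → ℕ
    col-sym : ∀ x y → col x y ≡ col y x
open EdgeColoring public

module _ {n N : ℕ} (H : Graph n) (c : EdgeColoring N) (φ : Fin n → Fin N) where

  Monochromatic : Set
  Monochromatic = ∃ λ κ → ∀ u v → Adj H u v → col c (φ u) (φ v) ≡ κ

  Rainbow : Set
  Rainbow = ∀ u v u′ v′ → Adj H u v → Adj H u′ v′ →
            col c (φ u) (φ v) ≡ col c (φ u′) (φ v′) →
            (u ≡ u′ × v ≡ v′) ⊎ (u ≡ v′ × v ≡ u′)

  Lexicographic : Set
  Lexicographic = Σ (Permutation′ n) λ σ → Σ (Fin n → ℕ) λ κ →
    Injective _≡_ _≡_ κ ×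
    (∀ i j → i F.< j → Adj H (σ ⟨$⟩ʳ i) (σ ⟨$⟩ʳ j) →
       col c (φ (σ ⟨$⟩ʳ i)) (φ (σ ⟨$⟩ʳ j)) ≡ κ i)

  CanonicalCopy : Set
  CanonicalCopy = Injective _≡_ _≡_ φ × (Monochromatic ⊎ Rainbow ⊎ Lexicographic)

ERExceeds : ∀ {n} → Graph n → ℕ → Set
ERExceeds {n} H M = Σ (EdgeColoring M) λ c → ∀ (φ : Fin n → Fin M) → ¬ CanonicalCopy H c φ

-- Colour the pair {x, y} of K_(2^k), k = ⌈nd/2Δ⌉ − 1, by the position of the highest binary digit
-- in which x and y differ. In a monochromatic copy of H that digit is a proper 2-colouring of H.
-- In a rainbow or lexicographic copy every colour class is a star, so it has at most Δ edges;
-- the k colour classes then hold at most kΔ < nd/2 edges, too few for H.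
module Submission where

open import Defs hiding (sym)
open import Data.Bool using (Bool; true; false; if_then_else_; _∧_; T)
open import Data.Fin using (Fin; zero; suc; toℕ; quotient; remainder; combine)
open import Data.Fin.Permutation using (_⟨$⟩ʳ_; _⟨$⟩ˡ_; inverseʳ)
open import Data.List using (map; foldr; allFin; tabulate)
open import Data.List.Properties using (map-tabulate)
open import Data.Nat
open import Data.Nat.DivMod using (m/n*n≤m)
open import Data.Nat.Properties
open import Algebra.Properties.CommutativeSemigroup +-commutativeSemigroup using () renaming (interchange to +-interchange)
open import Algebra.Properties.Monoid.Sum +-0-monoid using (sum; sum-syntax; sum-cong-≗; sum-replicate-zero)
import Data.Nat.ListAction as List
open import Data.Product using (∃; _×_; _,_; proj₁; proj₂)
open import Data.Sum using (_⊎_; inj₁; inj₂)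
import Data.Sum as Sum
open import Function using (_∘_; id)
open import Function.Definitions using (Injective)
open import Relation.Binary.Definitions using (tri<; tri≈; tri>)
open import Relation.Binary.PropositionalEquality
open import Relation.Nullary using (¬_; Dec; does; yes; no; contradiction)
open import Relation.Nullary.Decidable using (dec-true)
import Data.Fin as Fin
import Data.Fin.Properties as Fin

private variable
  n k : ℕ

sum-mono-≤ : {f g : Fin n → ℕ} → (∀ i → f i ≤ g i) → sum f ≤ sum g
sum-mono-≤ {zero}  f≤g = z≤n
sum-mono-≤ {suc n} f≤g = +-mono-≤ (f≤g zero) (sum-mono-≤ (f≤g ∘ suc))

sum-+ : (f g : Fin n → ℕ) → ∑[ i < n ] (f i + g i) ≡ sum f + sum g
sum-+ {zero}  f g = refl
sum-+ {suc n} f g =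
  trans (cong (f zero + g zero +_) (sum-+ (f ∘ suc) (g ∘ suc))) (+-interchange (f zero) (g zero) _ _)

*-distribˡ-sum : ∀ a (f : Fin n → ℕ) → ∑[ i < n ] (a * f i) ≡ a * sum f
*-distribˡ-sum {zero}  a f = sym (*-zeroʳ a)
*-distribˡ-sum {suc n} a f =
  trans (cong (a * f zero +_) (*-distribˡ-sum a (f ∘ suc))) (sym (*-distribˡ-+ a (f zero) _))

sum-swap : ∀ {m} (f : Fin n → Fin m → ℕ) → ∑[ i < n ] sum (f i) ≡ ∑[ j < m ] ∑[ i < n ] f i j
sum-swap {zero}  {m} f = sym (sum-replicate-zero m)
sum-swap {suc n} f =
  trans (cong (sum (f zero) +_) (sum-swap (f ∘ suc))) (sym (sum-+ (f zero) _))

sum-≤-* : ∀ {b} (f : Fin n → ℕ) → (∀ i → f i ≤ b) → sum f ≤ n * b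
sum-≤-* {zero}  f f≤b = z≤n
sum-≤-* {suc n} f f≤b = +-mono-≤ (f≤b zero) (sum-≤-* (f ∘ suc) (f≤b ∘ suc))

≤-sum : (f : Fin n → ℕ) (i : Fin n) → f i ≤ sum f
≤-sum f zero    = m≤m+n _ _
≤-sum f (suc i) = ≤-trans (≤-sum (f ∘ suc) i) (m≤n+m _ _)

sum≢0⇒∃≢0 : (f : Fin n → ℕ) → sum f ≢ 0 → ∃ λ i → f i ≢ 0
sum≢0⇒∃≢0 {zero}  f ∑f≢0 = contradiction refl ∑f≢0
sum≢0⇒∃≢0 {suc n} f ∑f≢0 with f zero ≟ 0
... | no f₀≢0 = zero , f₀≢0
... | yes f₀≡0 =
  let i , fᵢ≢0 = sum≢0⇒∃≢0 (f ∘ suc) (λ ∑≡0 → ∑f≢0 (cong₂ _+_ f₀≡0 ∑≡0)) in suc i , fᵢ≢0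

𝟙 : Bool → ℕ
𝟙 b = if b then 1 else 0

⟦_⟧ : ∀ {a} {A : Set a} → Dec A → ℕ
⟦ a? ⟧ = 𝟙 (does a?)

1≤⟦_⟧ : ∀ {a} {A : Set a} (a? : Dec A) → A → 1 ≤ ⟦ a? ⟧
1≤⟦ a? ⟧ a rewrite dec-true a? a = ≤-refl

sum-select : (w : Fin n) (h : Fin n → ℕ) → ∑[ i < n ] (⟦ i Fin.≟ w ⟧ * h i) ≡ h w
sum-select {suc n} zero h =
  trans (cong (h zero + 0 +_) (sum-replicate-zero n)) (trans (+-identityʳ _) (+-identityʳ _))
sum-select {suc n} (suc w) h = sum-select w (h ∘ suc)

sum-𝟙-≡ᵇ : ∀ {x} → x < k → ∑[ c < k ] 𝟙 (x ≡ᵇ toℕ c) ≡ 1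
sum-𝟙-≡ᵇ {suc k} {zero}  _         = cong suc (sum-replicate-zero k)
sum-𝟙-≡ᵇ {suc k} {suc x} (s≤s x<k) = sum-𝟙-≡ᵇ x<k

sumList-allFin : (f : Fin n → ℕ) → List.sum (map f (allFin n)) ≡ sum f
sumList-allFin f = trans (cong List.sum (map-tabulate id f)) (sumList-tabulate f)
  where
  sumList-tabulate : ∀ {n} (g : Fin n → ℕ) → List.sum (tabulate g) ≡ sum g
  sumList-tabulate {zero}  g = refl
  sumList-tabulate {suc n} g = cong (g zero +_) (sumList-tabulate (g ∘ suc))

≤-maxList-allFin : (f : Fin n → ℕ) (i : Fin n) → f i ≤ foldr _⊔_ 0 (map f (allFin n))
≤-maxList-allFin f i rewrite map-tabulate id f = ≤-maxList-tabulate f i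
  where
  ≤-maxList-tabulate : ∀ {n} (g : Fin n → ℕ) i → g i ≤ foldr _⊔_ 0 (tabulate g)
  ≤-maxList-tabulate g zero    = m≤m⊔n _ _
  ≤-maxList-tabulate g (suc i) = ≤-trans (≤-maxList-tabulate (g ∘ suc) i) (m≤n⊔m (g zero) _)

module _ {n} (H : Graph n) where

  Adj⇒≢ : ∀ {u v} → Adj H u v → u ≢ v
  Adj⇒≢ {u} uv refl = contradiction (trans (sym uv) (irrefl H u)) λ ()

  deg≡sum : ∀ u → deg H u ≡ ∑[ v < n ] 𝟙 (adj H u v)
  deg≡sum u = sumList-allFin (𝟙 ∘ adj H u)

  deg≤maxDeg : ∀ u → deg H u ≤ maxDeg H
  deg≤maxDeg = ≤-maxList-allFin (deg H)

  degSum≡sum : degSum H ≡ ∑[ u < n ] ∑[ v < n ] 𝟙 (adj H u v)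
  degSum≡sum = trans (sumList-allFin (deg H)) (sum-cong-≗ deg≡sum)

  Adj⇒0<degSum : ∀ {u v} → Adj H u v → 0 < degSum H
  Adj⇒0<degSum {u} {v} uv = begin-strict
    0                         <⟨ subst (λ b → 0 < 𝟙 b) (sym uv) z<s ⟩
    𝟙 (adj H u v)             ≤⟨ ≤-sum (𝟙 ∘ adj H u) v ⟩
    ∑[ v < n ] 𝟙 (adj H u v)  ≡⟨ deg≡sum u ⟨
    deg H u                   ≤⟨ ≤-sum (deg H) u ⟩
    ∑[ u < n ] deg H u        ≡⟨ sumList-allFin (deg H) ⟨
    degSum H                  ∎
    where open ≤-Reasoning

  ¬2-colourable⇒0<degSum : ¬ Colorable H 2 → 0 < degSum H
  ¬2-colourable⇒0<degSum ¬2-colourable = n≢0⇒n>0 λ degSum≡0 →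
    ¬2-colourable ((λ _ → zero) , λ u v uv _ → <⇒≢ (Adj⇒0<degSum uv) (sym degSum≡0))

  ColourClassesAreStars : (Fin n → Fin n → ℕ) → Set
  ColourClassesAreStars f = ∀ {u₀ v₀} → Adj H u₀ v₀ →
    ∃ λ w → ∀ {u v} → Adj H u v → f u v ≡ f u₀ v₀ → u ≡ w ⊎ v ≡ w

  inColour : (Fin n → Fin n → ℕ) → ℕ → Fin n → Fin n → ℕ
  inColour f c u v = 𝟙 (adj H u v ∧ (f u v ≡ᵇ c))

  inColour≢0⇒ : ∀ {f c u v} → inColour f c u v ≢ 0 → Adj H u v × f u v ≡ c
  inColour≢0⇒ {f} {c} {u} {v} ≢0 with adj H u v | f u v ≡ᵇ c in fuv≡ᵇc
  ... | false | _     = contradiction refl ≢0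
  ... | true  | false = contradiction refl ≢0
  ... | true  | true  = refl , ≡ᵇ⇒≡ (f u v) c (subst T (sym fuv≡ᵇc) _)

  -- Ordered pairs: every edge of colour c is counted twice.
  classSize : (Fin n → Fin n → ℕ) → ℕ → ℕ
  classSize f c = ∑[ u < n ] ∑[ v < n ] inColour f c u v

  degSum≡sum-classSize : ∀ {k} (f : Fin n → Fin n → ℕ) → (∀ {u v} → Adj H u v → f u v < k) →
                         degSum H ≡ ∑[ c < k ] classSize f (toℕ c)
  degSum≡sum-classSize {k} f f<k = begin
    degSum H
      ≡⟨ degSum≡sum ⟩
    ∑[ u < n ] ∑[ v < n ] 𝟙 (adj H u v)
      ≡⟨ sum-cong-≗ (λ u → sum-cong-≗ (edge≡sum-colours u)) ⟩
    ∑[ u < n ] ∑[ v < n ] ∑[ c < k ] inClass u v c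
      ≡⟨ sum-cong-≗ (λ u → sum-swap (inClass u)) ⟩
    ∑[ u < n ] ∑[ c < k ] ∑[ v < n ] inClass u v c
      ≡⟨ sum-swap (λ u c → ∑[ v < n ] inClass u v c) ⟩
    ∑[ c < k ] classSize f (toℕ c)
      ∎
    where
    open ≡-Reasoning
    inClass : Fin n → Fin n → Fin k → ℕ
    inClass u v c = inColour f (toℕ c) u v
    edge≡sum-colours : ∀ u v → 𝟙 (adj H u v) ≡ ∑[ c < k ] inClass u v c
    edge≡sum-colours u v with adj H u v in uv
    ... | false = sym (sum-replicate-zero k)
    ... | true  = sym (sum-𝟙-≡ᵇ (f<k uv))

  classSize-star : ∀ {f c} w → (∀ {u v} → Adj H u v → f u v ≡ c → u ≡ w ⊎ v ≡ w) →
                   classSize f c ≤ deg H w + deg H w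
  classSize-star {f} {c} w star = begin
    classSize f c
      ≤⟨ sum-mono-≤ (λ u → sum-mono-≤ (inClass≤ u)) ⟩
    ∑[ u < n ] ∑[ v < n ] (atTail u v + atHead u v)
      ≡⟨ sum-cong-≗ (λ u → sum-+ (atTail u) (atHead u)) ⟩
    ∑[ u < n ] (sum (atTail u) + sum (atHead u))
      ≡⟨ sum-+ (sum ∘ atTail) (sum ∘ atHead) ⟩
    ∑[ u < n ] sum (atTail u) + ∑[ u < n ] sum (atHead u)
      ≡⟨ cong₂ _+_ (row edge) (trans (sum-swap atHead) (row (λ v u → edge u v))) ⟩
    ∑[ v < n ] edge w v + ∑[ u < n ] edge u w
      ≡⟨ cong (∑[ v < n ] edge w v +_) (sum-cong-≗ (λ u → cong 𝟙 (Graph.sym H u w))) ⟩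
    ∑[ v < n ] edge w v + ∑[ v < n ] edge w v
      ≡⟨ cong₂ _+_ (deg≡sum w) (deg≡sum w) ⟨
    deg H w + deg H w
      ∎
    where
    open ≤-Reasoning
    edge : Fin n → Fin n → ℕ
    edge u v = 𝟙 (adj H u v)
    atTail atHead : Fin n → Fin n → ℕ
    atTail u v = ⟦ u Fin.≟ w ⟧ * edge u v
    atHead u v = ⟦ v Fin.≟ w ⟧ * edge u v
    row : (g : Fin n → Fin n → ℕ) → ∑[ u < n ] ∑[ v < n ] (⟦ u Fin.≟ w ⟧ * g u v) ≡ ∑[ v < n ] g w v
    row g = trans (sum-cong-≗ (λ u → *-distribˡ-sum ⟦ u Fin.≟ w ⟧ (g u))) (sum-select w (sum ∘ g))
    inClass≤ : ∀ u v → inColour f c u v ≤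
                       ⟦ u Fin.≟ w ⟧ * 𝟙 (adj H u v) + ⟦ v Fin.≟ w ⟧ * 𝟙 (adj H u v)
    inClass≤ u v with adj H u v in uv | f u v ≡ᵇ c in fuv≡ᵇc
    ... | false | _     = z≤n
    ... | true  | false = z≤n
    ... | true  | true rewrite *-identityʳ ⟦ u Fin.≟ w ⟧ | *-identityʳ ⟦ v Fin.≟ w ⟧
      with star uv (≡ᵇ⇒≡ (f u v) c (subst T (sym fuv≡ᵇc) _))
    ... | inj₁ u≡w = ≤-trans (1≤⟦ u Fin.≟ w ⟧ u≡w) (m≤m+n _ _)
    ... | inj₂ v≡w = ≤-trans (1≤⟦ v Fin.≟ w ⟧ v≡w) (m≤n+m _ _)

  classSize≤2*maxDeg : ∀ {f} → ColourClassesAreStars f → ∀ c → classSize f c ≤ 2 * maxDeg H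
  classSize≤2*maxDeg {f} stars c with classSize f c ≟ 0
  ... | yes empty = subst (_≤ 2 * maxDeg H) (sym empty) z≤n
  ... | no nonempty =
    let u₀ , row≢0  = sum≢0⇒∃≢0 (λ u → ∑[ v < n ] inColour f c u v) nonempty
        v₀ , edge≢0 = sum≢0⇒∃≢0 (inColour f c u₀) row≢0
        u₀v₀ , fu₀v₀≡c = inColour≢0⇒ {f} edge≢0
        w , star = stars u₀v₀
    in ≤-trans (classSize-star w (λ uv fuv≡c → star uv (trans fuv≡c (sym fu₀v₀≡c))))
               (+-mono-≤ (deg≤maxDeg w) (≤-trans (deg≤maxDeg w) (m≤m+n _ 0)))

  degSum≤colours*2*maxDeg : ∀ {k} (f : Fin n → Fin n → ℕ) → (∀ {u v} → Adj H u v → f u v < k) →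
                            ColourClassesAreStars f → degSum H ≤ k * (2 * maxDeg H)
  degSum≤colours*2*maxDeg {k} f f<k stars =
    ≤-trans (≤-reflexive (degSum≡sum-classSize f f<k))
            (sum-≤-* {k} (classSize f ∘ toℕ) (λ c → classSize≤2*maxDeg stars (toℕ c)))

induced : ∀ {N} → EdgeColoring N → (Fin n → Fin N) → Fin n → Fin n → ℕ
induced c φ u v = col c (φ u) (φ v)

module _ {n N} (H : Graph n) (c : EdgeColoring N) (φ : Fin n → Fin N) where

  rainbow⇒stars : Rainbow H c φ → ColourClassesAreStars H (induced c φ)
  rainbow⇒stars rainbow {u₀} {v₀} u₀v₀ =
    u₀ , λ uv same → Sum.map proj₁ proj₂ (rainbow _ _ u₀ v₀ uv u₀v₀ same)

  -- Each edge carries the colour κ of its earlier endpoint, and κ is injective.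
  lexicographic⇒stars : Lexicographic H c φ → ColourClassesAreStars H (induced c φ)
  lexicographic⇒stars (σ , κ , κ-injective , forward) u₀v₀ =
    let m₀ , κm₀ , _ = earlierEnd u₀v₀
    in σ ⟨$⟩ʳ m₀ , λ uv same →
         let m , κm , endpoint = earlierEnd uv
         in subst (λ m → _ ≡ σ ⟨$⟩ʳ m ⊎ _ ≡ σ ⟨$⟩ʳ m) (κ-injective (trans (sym κm) (trans same κm₀))) endpoint
    where
    position : Fin n → Fin n
    position = σ ⟨$⟩ˡ_

    forward′ : ∀ {u v} → Adj H u v → position u Fin.< position v → induced c φ u v ≡ κ (position u)
    forward′ {u} {v} uv lt =
      subst₂ (λ x y → induced c φ x y ≡ κ (position u)) (inverseʳ σ) (inverseʳ σ)
        (forward _ _ lt (subst₂ (Adj H) (sym (inverseʳ σ)) (sym (inverseʳ σ)) uv))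

    earlierEnd : ∀ {u v} → Adj H u v → ∃ λ m → induced c φ u v ≡ κ m × (u ≡ σ ⟨$⟩ʳ m ⊎ v ≡ σ ⟨$⟩ʳ m)
    earlierEnd {u} {v} uv with Fin.<-cmp (position u) (position v)
    ... | tri< u<v _ _ = position u , forward′ uv u<v , inj₁ (sym (inverseʳ σ))
    ... | tri≈ _ u≈v _ =
      contradiction (trans (sym (inverseʳ σ)) (trans (cong (σ ⟨$⟩ʳ_) u≈v) (inverseʳ σ))) (Adj⇒≢ H uv)
    ... | tri> _ _ v<u =
      position v , trans (col-sym c _ _) (forward′ (trans (Graph.sym H v u) uv) v<u) , inj₂ (sym (inverseʳ σ))

highDigit : ∀ k → Fin (2 ^ suc k) → Fin 2
highDigit k = quotient {2} (2 ^ k)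

lowDigits : ∀ k → Fin (2 ^ suc k) → Fin (2 ^ k)
lowDigits k = remainder {2} (2 ^ k)

digits-injective : ∀ {x y} → highDigit k x ≡ highDigit k y → lowDigits k x ≡ lowDigits k y → x ≡ y
digits-injective {k} {x} {y} high≡ low≡ =
  trans (sym (Fin.combine-remQuot {2} (2 ^ k) x)) (trans (cong₂ combine high≡ low≡) (Fin.combine-remQuot {2} (2 ^ k) y))

digit : ∀ k → ℕ → Fin (2 ^ k) → Fin 2
digit zero    i x = zero
digit (suc k) i x with i ≟ k
... | yes _ = highDigit k x
... | no _  = digit k i (lowDigits k x)

digit-top : ∀ x → digit (suc k) k x ≡ highDigit k x
digit-top {k} x with k ≟ k
... | yes _   = refl
... | no k≢k = contradiction refl k≢k

digit-below : ∀ {i} → i < k → ∀ x → digit (suc k) i x ≡ digit k i (lowDigits k x)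
digit-below {k} {i} i<k x with i ≟ k
... | yes i≡k = contradiction i≡k (<⇒≢ i<k)
... | no _    = refl

-- Digits are indexed from the least significant one, so this is ⌊log₂ (x xor y)⌋ for x ≠ y.
highestDifference : ∀ k → Fin (2 ^ k) → Fin (2 ^ k) → ℕ
highestDifference zero    x y = 0
highestDifference (suc k) x y with highDigit k x Fin.≟ highDigit k y
... | yes _ = highestDifference k (lowDigits k x) (lowDigits k y)
... | no _  = k

highestDifference-sym : ∀ k x y → highestDifference k x y ≡ highestDifference k y x
highestDifference-sym zero    x y = refl
highestDifference-sym (suc k) x y with highDigit k x Fin.≟ highDigit k y | highDigit k y Fin.≟ highDigit k x
... | yes _  | yes _  = highestDifference-sym k _ _
... | no _   | no _   = refl
... | yes xy | no ¬yx = contradiction (sym xy) ¬yx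
... | no ¬xy | yes yx = contradiction (sym yx) ¬xy

highestDifference-spec : ∀ k {x y} → x ≢ y →
  let i = highestDifference k x y in i < k × digit k i x ≢ digit k i y
highestDifference-spec zero {zero} {zero} x≢y = contradiction refl x≢y
highestDifference-spec (suc k) {x} {y} x≢y with highDigit k x Fin.≟ highDigit k y
... | no high≢ = n<1+n k , λ digit≡ → high≢ (trans (sym (digit-top {k} x)) (trans digit≡ (digit-top {k} y)))
... | yes high≡ =
  let i<k , digit≢ = highestDifference-spec k (x≢y ∘ digits-injective {k} high≡)
  in m<n⇒m<1+n i<k , λ digit≡ → digit≢ (trans (sym (digit-below {k} i<k x)) (trans digit≡ (digit-below {k} i<k y)))

binaryColouring : ∀ k → EdgeColoring (2 ^ k)
binaryColouring k = record { col = highestDifference k ; col-sym = highestDifference-sym k }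

module _ {n} k (H : Graph n) {φ : Fin n → Fin (2 ^ k)} (φ-injective : Injective _≡_ _≡_ φ) where

  Adj⇒φ≢ : ∀ {u v} → Adj H u v → φ u ≢ φ v
  Adj⇒φ≢ uv = Adj⇒≢ H uv ∘ φ-injective

  binaryColour<k : ∀ {u v} → Adj H u v → induced (binaryColouring k) φ u v < k
  binaryColour<k uv = proj₁ (highestDifference-spec k (Adj⇒φ≢ uv))

  monochromatic⇒2-colourable : Monochromatic H (binaryColouring k) φ → Colorable H 2
  monochromatic⇒2-colourable (κ , mono) =
    (λ u → digit k κ (φ u)) ,
    λ u v uv → subst (λ i → digit k i (φ u) ≢ digit k i (φ v)) (mono u v uv)
                     (proj₂ (highestDifference-spec k (Adj⇒φ≢ uv)))

ceilDiv∸1*< : ∀ {a} b → 0 < a → (ceilDiv a b ∸ 1) * b < a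
ceilDiv∸1*< {a} zero    0<a = subst (_< a) (sym (*-zeroʳ (ceilDiv a 0 ∸ 1))) 0<a
ceilDiv∸1*< {suc a} (suc b) _ = begin-strict
  (q ∸ 1) * suc b            ≡⟨ *-distribʳ-∸ (suc b) q 1 ⟩
  q * suc b ∸ 1 * suc b      ≤⟨ ∸-monoˡ-≤ (1 * suc b) (m/n*n≤m (suc a + b) (suc b)) ⟩
  suc a + b ∸ 1 * suc b      ≡⟨ cong (suc a + b ∸_) (*-identityˡ (suc b)) ⟩
  suc a + b ∸ suc b          ≡⟨ m+n∸n≡m a b ⟩
  a                          <⟨ n<1+n a ⟩
  suc a                      ∎
  where
  open ≤-Reasoning
  q : ℕ
  q = (suc a + b) / suc b

theorem2p3 : ∀ (n : ℕ) (H : Graph n) → ¬ Colorable H 2 →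
    ERExceeds H (2 ^ (ceilDiv (degSum H) (2 * maxDeg H) ∸ 1))
theorem2p3 n H ¬2-colourable = binaryColouring bits , noCanonicalCopy
  where
  bits : ℕ
  bits = ceilDiv (degSum H) (2 * maxDeg H) ∸ 1

  notAllStars : ∀ φ → Injective _≡_ _≡_ φ → ¬ ColourClassesAreStars H (induced (binaryColouring bits) φ)
  notAllStars φ φ-injective stars =
    <⇒≱ (ceilDiv∸1*< (2 * maxDeg H) (¬2-colourable⇒0<degSum H ¬2-colourable))
        (degSum≤colours*2*maxDeg H (induced (binaryColouring bits) φ) (binaryColour<k bits H φ-injective) stars)

  noCanonicalCopy : ∀ φ → ¬ CanonicalCopy H (binaryColouring bits) φ
  noCanonicalCopy φ (φ-injective , inj₁ mono) =
    ¬2-colourable (monochromatic⇒2-colourable bits H φ-injective mono)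
  noCanonicalCopy φ (φ-injective , inj₂ (inj₁ rainbow)) =
    notAllStars φ φ-injective (rainbow⇒stars H (binaryColouring bits) φ rainbow)
  noCanonicalCopy φ (φ-injective , inj₂ (inj₂ lexicographic)) =
    notAllStars φ φ-injective (lexicographic⇒stars H (binaryColouring bits) φ lexicographic)
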